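{- Let $G$ be a connected graph with maximum degree $\Delta$ and tree-depth $t\geq 1$. Then $G$ has order $n\leq 1+\Delta+\dots+\Delta^{t-1}$.
   Context: A rooted forest is a disjoint union of rooted trees. The height of a vertex $x$ in a rooted forest $F$ is the number of vertices on the path from the root of its tree to $x$; the height of $F$ is the maximum height of its vertices. A vertex $x$ is an ancestor of $y$ in $F$ if $x$ lies on the path from $y$ to the root of the tree containing $y$. The closure $\mathrm{clos}(F)$ is the graph on $V(F)$ with edge set $\{\{x,y\}: x\neq y,\ x \text{ is an ancestor of } y \text{ in } F\}$. The tree-depth $\mathrm{td}(G)$ of a graph $G$ is the minimum height of a rooted forest $F$ such that $G\subseteq \mathrm{clos}(F)$. -}

module Defs where

open import Data.Nat using (ℕ; zero; suc; _⊔_; _^_; _≤_)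
open import Data.Bool using (Bool; true; false; if_then_else_)
open import Data.Fin using (Fin)
open import Data.List using (List; map; foldr; allFin; upTo)
open import Data.Nat.ListAction using (sum)
open import Data.Maybe using (Maybe; just; nothing)
open import Data.Product using (Σ; _×_; _,_)
open import Data.Sum using (_⊎_)
open import Relation.Binary.PropositionalEquality using (_≡_; _≢_)

record Graph (n : ℕ) : Set where
  field
    adj   : Fin n → Fin n → Bool
    sym   : ∀ u v → adj u v ≡ adj v u
    irrefl : ∀ v → adj v v ≡ false
open Graph public

maxOver : ∀ {n} → (Fin n → ℕ) → ℕ
maxOver {n} f = foldr _⊔_ 0 (map f (allFin n))

degree : ∀ {n} → Graph n → Fin n → ℕ
degree {n} G v = sum (map (λ w → if adj G v w then 1 else 0) (allFin n))

maxDegree : ∀ {n} → Graph n → ℕ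
maxDegree G = maxOver (degree G)

data Walk {n} (G : Graph n) : Fin n → Fin n → Set where
  here : ∀ {v} → Walk G v v
  step : ∀ {u w v} → adj G u w ≡ true → Walk G w v → Walk G u v

Connected : ∀ {n} → Graph n → Set
Connected G = ∀ u v → Walk G u v

-- A rooted forest on Fin n: a parent map (nothing = root) together with the
-- height function (number of vertices on the path from the root), whose
-- existence is exactly acyclicity of the parent map.
record RootedForest (n : ℕ) : Set where
  field
    parent     : Fin n → Maybe (Fin n)
    height     : Fin n → ℕ
    height-root : ∀ v → parent v ≡ nothing → height v ≡ 1
    height-step : ∀ v p → parent v ≡ just p → height v ≡ suc (height p)
open RootedForest public

forestHeight : ∀ {n} → RootedForest n → ℕ
forestHeight F = maxOver (height F)

data Ancestor {n} (F : RootedForest n) (x : Fin n) : Fin n → Set where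
  anc-refl : Ancestor F x x
  anc-step : ∀ {y p} → parent F y ≡ just p → Ancestor F x p → Ancestor F x y

ClosEdge : ∀ {n} → RootedForest n → Fin n → Fin n → Set
ClosEdge F x y = x ≢ y × (Ancestor F x y ⊎ Ancestor F y x)

SubClos : ∀ {n} → Graph n → RootedForest n → Set
SubClos G F = ∀ u v → adj G u v ≡ true → ClosEdge F u v

TreeDepth : ∀ {n} → Graph n → ℕ → Set
TreeDepth {n} G t =
  Σ (RootedForest n) (λ F → SubClos G F × forestHeight F ≡ t)
  × (∀ (F : RootedForest n) → SubClos G F → t ≤ forestHeight F)

geomSum : ℕ → ℕ → ℕ
geomSum Δ t = sum (map (Δ ^_) (upTo t))

-- Fix a rooted forest F of height t whose closure contains G.  If a vertex set S
-- induces a connected subgraph, a vertex r of S of minimum height is an ancestor of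
-- every vertex of S, because every edge joins an ancestor to a descendant.  Every
-- component of S - r contains a neighbour of r and lies strictly below r, so by
-- induction on the number k of heights occupied by S,
-- |S| <= 1 + Δ (1 + Δ + ... + Δ^(k-2)) = 1 + Δ + ... + Δ^(k-1).

module Submission where

open import Defs hiding (sym)
open import Data.Nat using (ℕ; zero; suc; _+_; _*_; _^_; _≤_; _<_; _⊔_; z≤n; s≤s; _≤?_)
open import Data.Nat.Properties
  using (≤-refl; ≤-trans; ≤-reflexive; +-mono-≤; +-monoˡ-≤; *-monoˡ-≤; *-monoʳ-≤;
         m≤m+n; m≤n+m; m≤m⊔n; m≤n⊔m; +-suc; +-identityʳ; <⇒≱; *-zeroʳ; *-distribˡ-+; +-*-semiring;
         module ≤-Reasoning)
open import Data.Nat.ListAction using (sum)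
open import Data.Bool using (Bool; true; false; T; not; _∧_; if_then_else_)
open import Data.Bool.Properties using (T-∧; T-≡)
open import Data.Fin using (Fin; _≟_) renaming (zero to fzero; suc to fsuc)
open import Data.List using ([]; _∷_; map; foldr; allFin; tabulate; applyUpTo; filter)
open import Data.List.Properties using (map-tabulate)
import Data.List.Relation.Unary.Any as Any
open import Data.List.Membership.Propositional using () renaming (_∈_ to _∈ˡ_)
open import Data.List.Membership.Propositional.Properties using (∈-allFin; ∈-map⁺; ∈-filter⁺)
open import Data.List.Relation.Unary.All using (All; _∷_)
open import Data.List.Relation.Unary.All.Properties using (all-filter)
open import Data.List.Extrema.Nat using (argmin; argmin-all; f[argmin]≤v⁺)
open import Data.Maybe using (just; nothing)
open import Data.Maybe.Properties using (just-injective)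
open import Data.Product using (∃; ∃-syntax; _×_; _,_; proj₁; proj₂)
open import Data.Sum using (_⊎_; inj₁; inj₂)
open import Function using (_∘_; Equivalence)
open import Relation.Nullary using (¬_; Dec; yes; no; contradiction)
open import Relation.Nullary.Negation using (DoubleNegation; ¬¬-map)
open import Relation.Nullary.Decidable
  using (⌊_⌋; T?; toWitness; fromWitness; toWitnessFalse; fromWitnessFalse;
         isNo; decidable-stable; ¬¬-excluded-middle; ⌊⌋-map′)
open import Relation.Binary.PropositionalEquality
  using (_≡_; _≢_; refl; sym; trans; cong; cong₂; subst)
open import Algebra.Properties.Semiring.Sum +-*-semiring
  using (sum-syntax; ∑-comm; ∑-distrib-+; *-distribˡ-sum; *-distribʳ-sum; sum-cong-≗; sum-replicate-zero)
  renaming (sum to ∑)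

𝟙 : Bool → ℕ
𝟙 b = if b then 1 else 0

∑-mono-≤ : ∀ {n} {f g : Fin n → ℕ} → (∀ i → f i ≤ g i) → ∑ f ≤ ∑ g
∑-mono-≤ {zero}  f≤g = z≤n
∑-mono-≤ {suc n} f≤g = +-mono-≤ (f≤g fzero) (∑-mono-≤ (f≤g ∘ fsuc))

f[i]≤∑f : ∀ {n} (f : Fin n → ℕ) i → f i ≤ ∑ f
f[i]≤∑f f fzero    = m≤m+n (f fzero) _
f[i]≤∑f f (fsuc i) = ≤-trans (f[i]≤∑f (f ∘ fsuc) i) (m≤n+m _ (f fzero))

∑-const-1 : ∀ n → ∑[ i < n ] 1 ≡ n
∑-const-1 zero    = refl
∑-const-1 (suc n) = cong suc (∑-const-1 n)

∑-𝟙-≟ : ∀ {n} (r : Fin n) → ∑[ v < n ] 𝟙 ⌊ v ≟ r ⌋ ≡ 1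
∑-𝟙-≟ {suc n} fzero    = cong suc (sum-replicate-zero n)
∑-𝟙-≟ {suc n} (fsuc r) =
  trans (sum-cong-≗ λ v → cong 𝟙 (⌊⌋-map′ _ _ (v ≟ r))) (∑-𝟙-≟ r)

sum-tabulate : ∀ {n} (f : Fin n → ℕ) → sum (tabulate f) ≡ ∑ f
sum-tabulate {zero}  f = refl
sum-tabulate {suc n} f = cong (f fzero +_) (sum-tabulate (f ∘ fsuc))

sum-map-allFin : ∀ {n} (f : Fin n → ℕ) → sum (map f (allFin n)) ≡ ∑ f
sum-map-allFin f = trans (cong sum (map-tabulate (λ i → i) f)) (sum-tabulate f)

∈⇒≤foldr-⊔ : ∀ {x xs} → x ∈ˡ xs → x ≤ foldr _⊔_ 0 xs
∈⇒≤foldr-⊔ (Any.here refl) = m≤m⊔n _ _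
∈⇒≤foldr-⊔ (Any.there x∈xs) = ≤-trans (∈⇒≤foldr-⊔ x∈xs) (m≤n⊔m _ _)

f[i]≤maxOver : ∀ {n} (f : Fin n → ℕ) i → f i ≤ maxOver f
f[i]≤maxOver f i = ∈⇒≤foldr-⊔ (∈-map⁺ f (∈-allFin i))

sum-^-shift : ∀ Δ (f : ℕ → ℕ) k →
  sum (map (Δ ^_) (applyUpTo (suc ∘ f) k)) ≡ Δ * sum (map (Δ ^_) (applyUpTo f k))
sum-^-shift Δ f zero    = sym (*-zeroʳ Δ)
sum-^-shift Δ f (suc k) =
  trans (cong (Δ ^ suc (f 0) +_) (sum-^-shift Δ (f ∘ suc) k))
        (sym (*-distribˡ-+ Δ (Δ ^ f 0) _))

geomSum-suc : ∀ Δ t → geomSum Δ (suc t) ≡ 1 + Δ * geomSum Δ t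
geomSum-suc Δ t = cong suc (sum-^-shift Δ (λ i → i) t)

¬¬-pull-Fin : ∀ {n} {P : Fin n → Set} → (∀ i → DoubleNegation (P i)) →
              DoubleNegation (∀ i → P i)
¬¬-pull-Fin {zero}  ¬¬P ¬∀P = ¬∀P λ ()
¬¬-pull-Fin {suc n} ¬¬P ¬∀P =
  ¬¬P fzero λ P0 → ¬¬-pull-Fin (¬¬P ∘ fsuc) λ Psuc →
    ¬∀P λ { fzero → P0 ; (fsuc i) → Psuc i }

module _ {n} (F : RootedForest n) where

  Ancestor-trans : ∀ {x y z} → Ancestor F x y → Ancestor F y z → Ancestor F x z
  Ancestor-trans x≼y anc-refl         = x≼y
  Ancestor-trans x≼y (anc-step e y≼p) = anc-step e (Ancestor-trans x≼y y≼p)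

  Ancestor⇒height≤ : ∀ {x y} → Ancestor F x y → height F x ≤ height F y
  Ancestor⇒height≤ anc-refl = ≤-refl
  Ancestor⇒height≤ {y = y} (anc-step {p = p} e x≼p) =
    ≤-trans (Ancestor⇒height≤ x≼p) (≤-trans (m≤n+m _ 1) (≤-reflexive (sym (height-step F y p e))))

  Ancestor⇒height< : ∀ {x y} → Ancestor F x y → x ≢ y → height F x < height F y
  Ancestor⇒height< anc-refl x≢x = contradiction refl x≢x
  Ancestor⇒height< {y = y} (anc-step {p = p} e x≼p) _ =
    ≤-trans (s≤s (Ancestor⇒height≤ x≼p)) (≤-reflexive (sym (height-step F y p e)))

  Ancestor-total : ∀ {x y z} → Ancestor F x z → Ancestor F y z → Ancestor F x y ⊎ Ancestor F y x
  Ancestor-total anc-refl           y≼z              = inj₂ y≼z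
  Ancestor-total (anc-step e x≼p)   anc-refl         = inj₁ (anc-step e x≼p)
  Ancestor-total (anc-step e x≼p)   (anc-step e′ y≼p′) with just-injective (trans (sym e) e′)
  ... | refl = Ancestor-total x≼p y≼p′

  0<height : ∀ v → 0 < height F v
  0<height v with parent F v in e
  ... | nothing = ≤-reflexive (sym (height-root F v e))
  ... | just p  = ≤-trans (s≤s z≤n) (≤-reflexive (sym (height-step F v p e)))

VertexSet : ℕ → Set
VertexSet n = Fin n → Bool

infix 4 _∈_ _∉_
infixl 6 _─_

_∈_ : ∀ {n} → Fin n → VertexSet n → Set
v ∈ S = T (S v)

_∉_ : ∀ {n} → Fin n → VertexSet n → Set
v ∉ S = ¬ v ∈ S

_─_ : ∀ {n} → VertexSet n → Fin n → VertexSet n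
(S ─ r) v = S v ∧ isNo (v ≟ r)

module _ {n} {S : VertexSet n} {r v : Fin n} where

  ∈-─⁺ : v ∈ S → v ≢ r → v ∈ S ─ r
  ∈-─⁺ v∈S v≢r = Equivalence.from (T-∧ {S v}) (v∈S , fromWitnessFalse v≢r)

  ∈-─⁻ : v ∈ S ─ r → v ∈ S × v ≢ r
  ∈-─⁻ v∈S─r with Equivalence.to (T-∧ {S v}) v∈S─r
  ... | v∈S , v≟r-no = v∈S , toWitnessFalse v≟r-no

Minimal : ∀ {n} → (Fin n → ℕ) → VertexSet n → Fin n → Set
Minimal f S r = r ∈ S × (∀ {v} → v ∈ S → f r ≤ f v)

empty⊎minimal : ∀ {n} (f : Fin n → ℕ) (S : VertexSet n) → (∀ v → v ∉ S) ⊎ ∃ (Minimal f S)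
empty⊎minimal {n} f S =
  search (filter (T? ∘ S) (allFin n)) (all-filter (T? ∘ S) (allFin n))
         (λ v∈S → ∈-filter⁺ (T? ∘ S) (∈-allFin _) v∈S)
  where
  ≤-at : ∀ {v x xs} → v ∈ˡ x ∷ xs → (f x ≤ f v) ⊎ Any.Any (λ y → f y ≤ f v) xs
  ≤-at (Any.here refl)   = inj₁ ≤-refl
  ≤-at (Any.there v∈xs) = inj₂ (Any.map (λ { refl → ≤-refl }) v∈xs)

  search : ∀ xs → All (_∈ S) xs → (∀ {v} → v ∈ S → v ∈ˡ xs) → (∀ v → v ∉ S) ⊎ ∃ (Minimal f S)
  search []       _              complete = inj₁ λ v v∈S → contradiction (complete v∈S) λ ()
  search (x ∷ xs) (x∈S ∷ xs⊆S) complete =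
    inj₂ (argmin f x xs , argmin-all f x∈S xs⊆S , λ v∈S → f[argmin]≤v⁺ x xs (≤-at (complete v∈S)))

count : ∀ {n} → VertexSet n → ℕ
count {n} S = ∑[ v < n ] 𝟙 (S v)

𝟙-T : ∀ {b} → T b → 𝟙 b ≡ 1
𝟙-T {true} _ = refl

𝟙-≤ : ∀ b {x} → (T b → 1 ≤ x) → 𝟙 b ≤ x
𝟙-≤ false _ = z≤n
𝟙-≤ true  h = h _

count-empty : ∀ {n} (S : VertexSet n) → (∀ v → v ∉ S) → count S ≡ 0
count-empty {n} S S-empty = trans (sum-cong-≗ λ v → 𝟙-¬T (S-empty v)) (sum-replicate-zero n)
  where
  𝟙-¬T : ∀ {b} → ¬ T b → 𝟙 b ≡ 0
  𝟙-¬T {false} _  = refl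
  𝟙-¬T {true}  ¬T = contradiction _ ¬T

count-─ : ∀ {n} (S : VertexSet n) r → count S ≤ 1 + count (S ─ r)
count-─ {n} S r = begin
  count S                                       ≤⟨ ∑-mono-≤ (λ v → 𝟙-split (S v) ⌊ v ≟ r ⌋) ⟩
  ∑[ v < n ] (𝟙 ⌊ v ≟ r ⌋ + 𝟙 ((S ─ r) v))     ≡⟨ ∑-distrib-+ (λ v → 𝟙 ⌊ v ≟ r ⌋) (𝟙 ∘ (S ─ r)) ⟩
  ∑[ v < n ] 𝟙 ⌊ v ≟ r ⌋ + count (S ─ r)       ≡⟨ cong (_+ count (S ─ r)) (∑-𝟙-≟ r) ⟩
  1 + count (S ─ r)                             ∎
  where
  open ≤-Reasoning
  𝟙-split : ∀ a b → 𝟙 a ≤ 𝟙 b + 𝟙 (a ∧ not b)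
  𝟙-split false _     = z≤n
  𝟙-split true  true  = ≤-refl
  𝟙-split true  false = ≤-refl

count≤count*bound : ∀ {m n c} (S : VertexSet n) (A : VertexSet m) (C : Fin m → VertexSet n) →
  (∀ u → count (C u) ≤ c) → (∀ {v} → v ∈ S → ∃[ u ] u ∈ A × v ∈ C u) → count S ≤ count A * c
count≤count*bound {m} {n} {c} S A C C≤c cover = begin
  count S                                          ≤⟨ ∑-mono-≤ covered ⟩
  ∑[ v < n ] ∑[ u < m ] (𝟙 (A u) * 𝟙 (C u v))     ≡⟨ ∑-comm (λ v u → 𝟙 (A u) * 𝟙 (C u v)) ⟩
  ∑[ u < m ] ∑[ v < n ] (𝟙 (A u) * 𝟙 (C u v))     ≡⟨ sum-cong-≗ (λ u → *-distribˡ-sum (𝟙 (A u)) (𝟙 ∘ C u)) ⟨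
  ∑[ u < m ] (𝟙 (A u) * count (C u))              ≤⟨ ∑-mono-≤ (λ u → *-monoʳ-≤ (𝟙 (A u)) (C≤c u)) ⟩
  ∑[ u < m ] (𝟙 (A u) * c)                        ≡⟨ *-distribʳ-sum c (𝟙 ∘ A) ⟨
  count A * c                                      ∎
  where
  open ≤-Reasoning
  covered : ∀ v → 𝟙 (S v) ≤ ∑[ u < m ] (𝟙 (A u) * 𝟙 (C u v))
  covered v = 𝟙-≤ (S v) λ v∈S →
    let (u , u∈A , v∈Cu) = cover v∈S
    in  ≤-trans (≤-reflexive (sym (cong₂ _*_ (𝟙-T u∈A) (𝟙-T v∈Cu)))) (f[i]≤∑f _ u)

module _ {n} (G : Graph n) where

  data WalkIn (S : VertexSet n) : Fin n → Fin n → Set where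
    here : ∀ {v} → v ∈ S → WalkIn S v v
    step : ∀ {u w v} → u ∈ S → adj G u w ≡ true → WalkIn S w v → WalkIn S u v

  ConnectedIn : VertexSet n → Set
  ConnectedIn S = ∀ {x y} → x ∈ S → y ∈ S → WalkIn S x y

  module _ {S : VertexSet n} where

    walk-start : ∀ {u v} → WalkIn S u v → u ∈ S
    walk-start (here u∈S)     = u∈S
    walk-start (step u∈S _ _) = u∈S

    walk-end : ∀ {u v} → WalkIn S u v → v ∈ S
    walk-end (here v∈S)   = v∈S
    walk-end (step _ _ p) = walk-end p

    via : ∀ {u x y} → WalkIn S u x → WalkIn S u y → WalkIn S x y
    via (here _)         q = q
    via (step _ u~w p) q = via p (step (walk-start p) (trans (Graph.sym G _ _) u~w) q)

    walk-within : ∀ {R u v} → (∀ {z} → WalkIn S u z → z ∈ R) → WalkIn S u v → WalkIn R u v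
    walk-within reached (here u∈S) = here (reached (here u∈S))
    walk-within reached (step u∈S u~w p) =
      step (reached (here u∈S)) u~w (walk-within (λ q → reached (step u∈S u~w q)) p)

    last-exit : ∀ {r u v} → WalkIn S u v → v ≢ r →
      (∃[ w ] adj G r w ≡ true × WalkIn (S ─ r) w v) ⊎ WalkIn (S ─ r) u v
    last-exit (here v∈S) v≢r = inj₂ (here (∈-─⁺ {S = S} v∈S v≢r))
    last-exit {r} {u} (step u∈S u~w p) v≢r with last-exit p v≢r
    ... | inj₁ exit = inj₁ exit
    ... | inj₂ q with u ≟ r
    ...   | yes refl = inj₁ (_ , u~w , q)
    ...   | no u≢r   = inj₂ (step (∈-─⁺ {S = S} u∈S u≢r) u~w q)

  component : ∀ {S} → (∀ u v → Dec (WalkIn S u v)) → Fin n → VertexSet n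
  component reach? u v = ⌊ reach? u v ⌋

  component-connected : ∀ {S} reach? {u} → ConnectedIn (component {S} reach? u)
  component-connected reach? x∈C y∈C = via (lift (toWitness x∈C)) (lift (toWitness y∈C))
    where
    lift : ∀ {u z} → WalkIn _ u z → WalkIn (component reach? u) u z
    lift = walk-within fromWitness

  Walk⇒WalkIn : ∀ {u v} → Walk G u v → WalkIn (λ _ → true) u v
  Walk⇒WalkIn here          = here _
  Walk⇒WalkIn (step u~w p) = step _ u~w (Walk⇒WalkIn p)

  count-adj≤maxDegree : ∀ v → count (adj G v) ≤ maxDegree G
  count-adj≤maxDegree v =
    subst (_≤ maxDegree G) (sum-map-allFin (𝟙 ∘ adj G v)) (f[i]≤maxOver (degree G) v)

HeightsWithin : ∀ {n} → RootedForest n → ℕ → ℕ → VertexSet n → Set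
HeightsWithin F b k S = ∀ {v} → v ∈ S → b < height F v × height F v ≤ b + k

module _ {n} {G : Graph n} {F : RootedForest n} (G⊆F : SubClos G F) where

  Ancestor-along-edge : ∀ {S r x y} → Minimal (height F) S r → adj G x y ≡ true → y ∈ S →
                        Ancestor F r x → Ancestor F r y
  Ancestor-along-edge {r = r} {y = y} (_ , r-min) x~y y∈S r≼x with proj₂ (G⊆F _ _ x~y)
  ... | inj₁ x≼y = Ancestor-trans F r≼x x≼y
  ... | inj₂ y≼x with Ancestor-total F r≼x y≼x
  ...   | inj₁ r≼y = r≼y
  ...   | inj₂ y≼r with y ≟ r
  ...     | yes refl = anc-refl
  ...     | no y≢r   = contradiction (r-min y∈S) (<⇒≱ (Ancestor⇒height< F y≼r y≢r))

  Ancestor-along-walk : ∀ {S r x y} → Minimal (height F) S r → WalkIn G S x y →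
                        Ancestor F r x → Ancestor F r y
  Ancestor-along-walk r-min (here _)         r≼x = r≼x
  Ancestor-along-walk r-min (step _ x~w p) r≼x =
    Ancestor-along-walk r-min p (Ancestor-along-edge r-min x~w (walk-start G p) r≼x)

  minimal⇒Ancestor : ∀ {S r v} → Minimal (height F) S r → ConnectedIn G S → v ∈ S → Ancestor F r v
  minimal⇒Ancestor r-min@(r∈S , _) S-connected v∈S =
    Ancestor-along-walk r-min (S-connected r∈S v∈S) anc-refl

  count≤geomSum : ∀ k b {S} → ConnectedIn G S → HeightsWithin F b k S →
                  count S ≤ geomSum (maxDegree G) k
  count≤geomSum zero b {S} _ heights = ≤-reflexive (count-empty S λ v v∈S →
    let (b<h , h≤b+0) = heights v∈S in <⇒≱ b<h (subst (_ ≤_) (+-identityʳ b) h≤b+0))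
  count≤geomSum (suc k) b {S} S-connected heights with empty⊎minimal (height F) S
  ... | inj₁ S-empty = ≤-trans (≤-reflexive (count-empty S S-empty)) z≤n
  ... | inj₂ (r , r-min@(r∈S , _)) = decidable-stable (_ ≤? _) (¬¬-map split components-decidable)
    where
    Δ = maxDegree G

    -- Reachability is only decided under double negation, which suffices because
    -- the goal is a decidable inequality.
    components-decidable : DoubleNegation (∀ u v → Dec (WalkIn G (S ─ r) u v))
    components-decidable = ¬¬-pull-Fin λ u → ¬¬-pull-Fin λ v → ¬¬-excluded-middle

    split : (∀ u v → Dec (WalkIn G (S ─ r) u v)) → count S ≤ geomSum Δ (suc k)
    split reach? = begin
      count S                              ≤⟨ count-─ S r ⟩
      1 + count (S ─ r)                    ≤⟨ s≤s (count≤count*bound (S ─ r) (adj G r) C C-bound cover) ⟩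
      1 + count (adj G r) * geomSum Δ k    ≤⟨ s≤s (*-monoˡ-≤ (geomSum Δ k) (count-adj≤maxDegree G r)) ⟩
      1 + Δ * geomSum Δ k                  ≡⟨ geomSum-suc Δ k ⟨
      geomSum Δ (suc k)                    ∎
      where
      open ≤-Reasoning
      C = component G reach?

      cover : ∀ {v} → v ∈ S ─ r → ∃[ u ] u ∈ adj G r × v ∈ C u
      cover v∈S─r with ∈-─⁻ {S = S} v∈S─r
      ... | v∈S , v≢r with last-exit G (S-connected r∈S v∈S) v≢r
      ...   | inj₁ (u , r~u , p) = u , Equivalence.from T-≡ r~u , fromWitness p
      ...   | inj₂ p = contradiction refl (proj₂ (∈-─⁻ {S = S} (walk-start G p)))

      C-heights : ∀ {u} → HeightsWithin F (height F r) k (C u)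
      C-heights {v = v} v∈Cu with ∈-─⁻ {S = S} (walk-end G (toWitness v∈Cu))
      ... | v∈S , v≢r =
        Ancestor⇒height< F (minimal⇒Ancestor r-min S-connected v∈S) (v≢r ∘ sym) ,
        (begin
          height F v      ≤⟨ proj₂ (heights v∈S) ⟩
          b + suc k       ≡⟨ +-suc b k ⟩
          suc b + k       ≤⟨ +-monoˡ-≤ k (proj₁ (heights r∈S)) ⟩
          height F r + k  ∎)

      C-bound : ∀ u → count (C u) ≤ geomSum Δ k
      C-bound u = count≤geomSum k (height F r) (component-connected G reach?) C-heights

mainTheorem1 : ∀ (n : ℕ) (G : Graph n) (t : ℕ) →
    Connected G → TreeDepth G t → 1 ≤ t →
    n ≤ geomSum (maxDegree G) t
mainTheorem1 n G t G-connected ((F , G⊆F , height≡t) , _) _ =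
  subst (_≤ geomSum (maxDegree G) t) (∑-const-1 n)
    (count≤geomSum G⊆F t 0 (λ _ _ → Walk⇒WalkIn G (G-connected _ _)) heights)
  where
  heights : HeightsWithin F 0 t (λ _ → true)
  heights {v} _ = 0<height F v , subst (height F v ≤_) height≡t (f[i]≤maxOver (height F) v)
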